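{- Let $\mathcal X$ be a sesquiclosed coherent configuration and $\varphi:\mathcal X\to\mathcal X'$ a sesquiclosed algebraic isomorphism. Then the coherent configuration $\mathcal X'$ is sesquiclosed.
   Context: A coherent configuration $\mathcal X=(\Omega,S)$ ($\Omega$ finite) is a partition $S$ of $\Omega^2$ with $1_\Omega$ a union of elements of $S$, $S$ closed under transposition $s\mapsto s^*$, and intersection numbers $c_{rs}^t=|\alpha r\cap\beta s^*|$ independent of $(\alpha,\beta)\in t$, where $\alpha r=\{\beta:(\alpha,\beta)\in r\}$. Basis relations: elements of $S$; relations: unions; fibers: $\Delta$ with $1_\Delta\in S$, $F(\mathcal X)$ their set. The one-point extension $\mathcal X_\alpha$ is the smallest coherent configuration whose relations include those of $\mathcal X$ and with $\{(\alpha,\alpha)\}$ a basis relation. An algebraic isomorphism $\varphi:\mathcal X\to\mathcal X'$ is a bijection $S\to S'$ preserving intersection numbers (extended to relations by unions; $\Delta^\varphi$ defined by $\varphi(1_\Delta)=1_{\Delta^\varphi}$). An $(\alpha,\alpha')$-extension of $\varphi$ is an algebraic isomorphism $\mathcal X_\alpha\to\mathcal X'_{\alpha'}$ agreeing with $\varphi$ on $S$ and mapping $1_{\{\alpha\}}$ to $1_{\{\alpha'\}}$; $\varphi$ is sesquiclosed if it has an $(\alpha,\alpha')$-extension whenever $\alpha\in\Delta\in F(\mathcal X)$, $\alpha'\in\Delta'\in F(\mathcal X')$, $\Delta^\varphi=\Delta'$. $\mathcal X$ is sesquiclosed if for every $\alpha\in\Omega$: (S1) $F(\mathcal X_\alpha)=\{\alpha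 s:s\in S,\ \alpha s\ne\emptyset\}$, and (S2) the identity algebraic automorphism of $\mathcal X$ is sesquiclosed. -}

module Defs where

open import Data.Nat using (ℕ; zero; suc; _+_)
open import Data.Fin using (Fin) renaming (zero to fz; suc to fs)
open import Data.Fin.Properties using (_≟_)
open import Data.Bool using (Bool; true; false; if_then_else_; _∧_)
open import Data.Product using (Σ; ∃; ∃₂; _×_; _,_)
open import Function.Bundles using (_⇔_)
open import Relation.Nullary.Decidable using (⌊_⌋)
open import Relation.Binary.PropositionalEquality using (_≡_; refl; sym; trans)

count : ∀ {n} → (Fin n → Bool) → ℕ
count {zero}  p = 0
count {suc n} p = (if p fz then 1 else 0) + count (λ i → p (fs i))

-- A coherent configuration on Ω = Fin n.  The partition S of Ω² is given by
-- a colouring col : Ω → Ω → Fin m, where the basis relations are the colour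
-- classes (all nonempty, so S is in bijection with Fin m).
record CC (n : ℕ) : Set where
  field
    m     : ℕ
    col   : Fin n → Fin n → Fin m
    surj  : ∀ (r : Fin m) → ∃₂ λ a b → col a b ≡ r
    -- 1_Ω is a union of basis relations
    diag  : ∀ a b c → col a b ≡ col c c → a ≡ b
    trans* : ∀ a b c d → col a b ≡ col c d → col b a ≡ col d c

  inter : Fin m → Fin m → Fin n → Fin n → ℕ
  inter r s α β = count (λ γ → ⌊ col α γ ≟ r ⌋ ∧ ⌊ col γ β ≟ s ⌋)

  field
    coh : ∀ r s a b c d → col a b ≡ col c d → inter r s a b ≡ inter r s c d

open CC public

_⊆ᵇ_ : ∀ {n} {Y X : CC n} → Fin (m Y) → Fin (m X) → Set
_⊆ᵇ_ {n} {Y} {X} u s = ∀ a b → col Y a b ≡ u → col X a b ≡ s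

Refines : ∀ {n} → CC n → CC n → Set
Refines Y X = ∀ a b c d → col Y a b ≡ col Y c d → col X a b ≡ col X c d

PointBasic : ∀ {n} → CC n → Fin n → Set
PointBasic Y α = ∀ a b → col Y a b ≡ col Y α α → (a ≡ α) × (b ≡ α)

IsOnePointExt : ∀ {n} → CC n → Fin n → CC n → Set
IsOnePointExt {n} X α Y =
  Refines Y X × PointBasic Y α ×
  (∀ (Z : CC n) → Refines Z X → PointBasic Z α → Refines Z Y)

record AlgIso {n n'} (X : CC n) (X' : CC n') : Set where
  field
    f    : Fin (m X) → Fin (m X')
    g    : Fin (m X') → Fin (m X)
    gf   : ∀ r → g (f r) ≡ r
    fg   : ∀ r → f (g r) ≡ r
    pres : ∀ r s a b a' b' → f (col X a b) ≡ col X' a' b' →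
           inter X r s a b ≡ inter X' (f r) (f s) a' b'

open AlgIso public

idIso : ∀ {n} (X : CC n) → AlgIso X X
idIso X = record
  { f = λ r → r ; g = λ r → r ; gf = λ _ → refl ; fg = λ _ → refl
  ; pres = λ r s a b a' b' e → coh X r s a b a' b' e }

IsExtension : ∀ {n n'} {X : CC n} {X' : CC n'} (φ : AlgIso X X')
              (α : Fin n) (α' : Fin n') (Y : CC n) (Y' : CC n') →
              AlgIso Y Y' → Set
IsExtension {X = X} {X' = X'} φ α α' Y Y' ψ =
  -- ψ agrees with φ on S: ψ(s) = ∪{ψ(u) : u ⊆ s} equals φ(s) for all s ∈ S
  (∀ (s : Fin (m X)) a' b' →
     (∃ λ (u : Fin (m Y)) → (_⊆ᵇ_ {Y = Y} {X = X} u s) × (f ψ u ≡ col Y' a' b'))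
       ⇔ (col X' a' b' ≡ f φ s))
  × (f ψ (col Y α α) ≡ col Y' α' α')

SesquiclosedIso : ∀ {n n'} {X : CC n} {X' : CC n'} → AlgIso X X' → Set
SesquiclosedIso {n} {n'} {X} {X'} φ =
  ∀ (α : Fin n) (α' : Fin n') →
  -- α ∈ Δ, α' ∈ Δ', Δ^φ = Δ'  (fibers given by diagonal colours)
  f φ (col X α α) ≡ col X' α' α' →
  ∀ (Y : CC n) (Y' : CC n') → IsOnePointExt X α Y → IsOnePointExt X' α' Y' →
  ∃ λ (ψ : AlgIso Y Y') → IsExtension φ α α' Y Y' ψ

IsFiberColour : ∀ {n} (Y : CC n) → Fin (m Y) → Set
IsFiberColour Y u = ∀ a b → col Y a b ≡ u → a ≡ b

S1 : ∀ {n} (X : CC n) (α : Fin n) (Y : CC n) → Set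
S1 X α Y =
  (∀ (u : Fin (m Y)) → IsFiberColour Y u →
     ∃ λ (s : Fin (m X)) → (∃ λ b → col X α b ≡ s) ×
       (∀ b → (col Y b b ≡ u) ⇔ (col X α b ≡ s)))
  × (∀ (s : Fin (m X)) → (∃ λ b → col X α b ≡ s) →
     ∃ λ (u : Fin (m Y)) → IsFiberColour Y u ×
       (∀ b → (col Y b b ≡ u) ⇔ (col X α b ≡ s)))

SesquiclosedCC : ∀ {n} → CC n → Set
SesquiclosedCC {n} X =
  (∀ (α : Fin n) (Y : CC n) → IsOnePointExt X α Y → S1 X α Y)
  × SesquiclosedIso (idIso X)

-- Every fibre of X' is the image under φ of a fibre of X, so for α' in X' there is α
-- with Δ_α^φ = Δ'_α', and sesquiclosedness of φ provides an (α, α')-extension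
-- ψ : X_α → X'_α'.  Since ψ preserves intersection numbers and sends the colour of
-- (α, α) to that of (α', α'), it sends colours of pairs (α, b) to colours of pairs
-- (α', b'), and then also the fibre of b to the fibre of b'.  So ψ
-- matches the rows α s of X with the rows α' s' of X' (where s' = φ s) and the fibres of
-- X_α with those of X'_α', and (S1) for X at α becomes (S1) for X' at α'.  For (S2), two
-- extensions ψ₁ : X_α → X'_α' and ψ₂ : X_α → X'_β' of φ compose to the extension
-- ψ₂ ψ₁⁻¹ of the identity of X'.  The one-point extension X_α itself is constructed by
-- Weisfeiler–Leman refinement.
module Submission where

open import Defs
open import Data.Bool using (Bool; true; false; if_then_else_; _∧_; T)
open import Data.Bool.Properties using (T-∧; ∧-comm) renaming (_≟_ to _≟ᵇ_)
open import Data.Empty using (⊥; ⊥-elim)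
open import Data.Fin using (Fin; zero; suc)
open import Data.Fin.Properties using (_≟_; any?; all?; suc-injective; *↔×)
open import Data.Nat using (ℕ; zero; suc; _+_; _≤_; _<_; z≤n; s≤s)
import Data.Nat as ℕ
open import Data.Nat.Properties
  using ( +-0-commutativeMonoid; +-mono-≤; +-monoʳ-≤; +-cancelʳ-≤; +-cancelˡ-≡; +-identityʳ
        ; m≤n+m; ≤-refl; ≤-trans; ≤-antisym; <-≤-trans; ≤∧≢⇒< )
open import Algebra.Properties.CommutativeMonoid.Sum +-0-commutativeMonoid
  using (sum; sum-syntax; ∑-comm; sum-cong-≗; sum-replicate-zero)
open import Data.Product using (Σ; ∃; _×_; _,_; proj₁; proj₂)
open import Data.Product.Properties using (≡-dec)
open import Function using (_∘_)
open import Function.Bundles using (_⇔_; mk⇔; Equivalence; _↔_; Inverse)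
open import Relation.Binary.PropositionalEquality
  using (_≡_; refl; sym; trans; cong; cong₂; subst; subst₂; module ≡-Reasoning)
open import Relation.Binary.Structures using (IsEquivalence; IsDecEquivalence)
import Relation.Binary.Construct.On as On
open import Relation.Nullary using (Dec; yes; no; does)
open import Relation.Nullary.Decidable
  using ( ⌊_⌋; T?; map′; _×-dec_; toWitness; fromWitness; does-⇔; isYes≗does; dec-true; ⌊⌋-map′ )

-- Booleans and counting

𝟙 : Bool → ℕ
𝟙 b = if b then 1 else 0

T-⇔⇒≡ : ∀ {x y : Bool} → (T x ⇔ T y) → x ≡ y
T-⇔⇒≡ {x} {y} x⇔y = does-⇔ x⇔y (T? x) (T? y)

𝟙-mono : ∀ {x y : Bool} → (T x → T y) → 𝟙 x ≤ 𝟙 y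
𝟙-mono {false} _   = z≤n
𝟙-mono {true} {true} _ = s≤s z≤n
𝟙-mono {true} {false} x⇒y = ⊥-elim (x⇒y _)

𝟙-injective : ∀ {x y : Bool} → 𝟙 x ≡ 𝟙 y → x ≡ y
𝟙-injective {false} {false} _ = refl
𝟙-injective {true}  {true}  _ = refl

T-≟∧≟ : ∀ {m} {x r y s : Fin m} → T (⌊ x ≟ r ⌋ ∧ ⌊ y ≟ s ⌋) ⇔ (x ≡ r × y ≡ s)
T-≟∧≟ {x = x} {r} {y} {s} = mk⇔
  (λ t → let (p , q) = Equivalence.to (T-∧ {⌊ x ≟ r ⌋} {⌊ y ≟ s ⌋}) t in toWitness p , toWitness q)
  (λ (p , q) → Equivalence.from (T-∧ {⌊ x ≟ r ⌋} {⌊ y ≟ s ⌋}) (fromWitness p , fromWitness q))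

count≡∑ : ∀ {n} (p : Fin n → Bool) → count p ≡ ∑[ i < n ] 𝟙 (p i)
count≡∑ {zero}  p = refl
count≡∑ {suc n} p = cong (𝟙 (p zero) +_) (count≡∑ (p ∘ suc))

count-cong : ∀ {n} {p q : Fin n → Bool} → (∀ i → p i ≡ q i) → count p ≡ count q
count-cong {p = p} {q} p≗q = begin
  count p               ≡⟨ count≡∑ p ⟩
  sum (λ i → 𝟙 (p i))   ≡⟨ sum-cong-≗ (cong 𝟙 ∘ p≗q) ⟩
  sum (λ i → 𝟙 (q i))   ≡⟨ count≡∑ q ⟨
  count q               ∎
  where open ≡-Reasoning

∃⇔0<count : ∀ {n} (p : Fin n → Bool) → (∃ λ i → T (p i)) ⇔ 0 < count p
∃⇔0<count p = mk⇔ (to p) (from p)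
  where
  to : ∀ {n} (p : Fin n → Bool) → (∃ λ i → T (p i)) → 0 < count p
  to p (zero , pi) with p zero
  ... | true = s≤s z≤n
  to p (suc i , pi) = ≤-trans (to (p ∘ suc) (i , pi)) (m≤n+m _ (𝟙 (p zero)))
  from : ∀ {n} (p : Fin n → Bool) → 0 < count p → ∃ λ i → T (p i)
  from {suc n} p pos with p zero in eq
  ... | true  = zero , subst T (sym eq) _
  ... | false = let (i , pi) = from (p ∘ suc) pos in suc i , pi

∑-if : ∀ {n} (c : Bool) (f : Fin n → ℕ) →
       (if c then ∑[ i < n ] f i else 0) ≡ ∑[ i < n ] (if c then f i else 0)
∑-if true  f = refl
∑-if {n} false f = sym (sum-replicate-zero n)

∑-δ : ∀ {m} (x : Fin m) (g : Fin m → ℕ) → ∑[ r < m ] (if ⌊ x ≟ r ⌋ then g r else 0) ≡ g x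
∑-δ {suc m} zero    g = trans (cong (g zero +_) (sum-replicate-zero m)) (+-identityʳ (g zero))
∑-δ         (suc x) g = trans (sum-cong-≗ (λ r → cong (λ b → if b then g (suc r) else 0) (⌊⌋-map′ _ _ (x ≟ r))))
                              (∑-δ x (g ∘ suc))

if-∧-nested : ∀ (c a b : Bool) →
  (if c then 𝟙 (a ∧ b) else 0) ≡ (if a then (if b then 𝟙 c else 0) else 0)
if-∧-nested true  true  true  = refl
if-∧-nested true  true  false = refl
if-∧-nested true  false b     = refl
if-∧-nested false true  true  = refl
if-∧-nested false true  false = refl
if-∧-nested false false b     = refl

count-by-fibres : ∀ {n m} (κ₁ κ₂ : Fin n → Fin m) (h : Fin m → Fin m → Bool) →
  count (λ γ → h (κ₁ γ) (κ₂ γ)) ≡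
  ∑[ r < m ] ∑[ s < m ] (if h r s then count (λ γ → ⌊ κ₁ γ ≟ r ⌋ ∧ ⌊ κ₂ γ ≟ s ⌋) else 0)
count-by-fibres {n} {m} κ₁ κ₂ h = sym (begin
  ∑[ r < m ] ∑[ s < m ] (if h r s then count (inFibre r s) else 0)
    ≡⟨ sum-cong-≗ (λ r → sum-cong-≗ (λ s → expand r s)) ⟩
  ∑[ r < m ] ∑[ s < m ] ∑[ γ < n ] F r s γ
    ≡⟨ sum-cong-≗ (λ r → ∑-comm (F r)) ⟩
  ∑[ r < m ] ∑[ γ < n ] ∑[ s < m ] F r s γ
    ≡⟨ ∑-comm (λ r γ → ∑[ s < m ] F r s γ) ⟩
  ∑[ γ < n ] ∑[ r < m ] ∑[ s < m ] F r s γ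
    ≡⟨ sum-cong-≗ fibre ⟩
  ∑[ γ < n ] 𝟙 (h (κ₁ γ) (κ₂ γ))
    ≡⟨ count≡∑ (λ γ → h (κ₁ γ) (κ₂ γ)) ⟨
  count (λ γ → h (κ₁ γ) (κ₂ γ)) ∎)
  where
  open ≡-Reasoning
  inFibre : Fin m → Fin m → Fin n → Bool
  inFibre r s γ = ⌊ κ₁ γ ≟ r ⌋ ∧ ⌊ κ₂ γ ≟ s ⌋
  F : Fin m → Fin m → Fin n → ℕ
  F r s γ = if h r s then 𝟙 (inFibre r s γ) else 0
  expand : ∀ r s → (if h r s then count (inFibre r s) else 0) ≡ ∑[ γ < n ] F r s γ
  expand r s = trans (cong (λ k → if h r s then k else 0) (count≡∑ (inFibre r s))) (∑-if (h r s) (𝟙 ∘ inFibre r s))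
  fibre : ∀ γ → ∑[ r < m ] ∑[ s < m ] F r s γ ≡ 𝟙 (h (κ₁ γ) (κ₂ γ))
  fibre γ = begin
    ∑[ r < m ] ∑[ s < m ] F r s γ
      ≡⟨ sum-cong-≗ (λ r → sum-cong-≗ (λ s → if-∧-nested (h r s) ⌊ κ₁ γ ≟ r ⌋ ⌊ κ₂ γ ≟ s ⌋)) ⟩
    ∑[ r < m ] ∑[ s < m ] (if ⌊ κ₁ γ ≟ r ⌋ then G r s else 0)
      ≡⟨ sum-cong-≗ (λ r → ∑-if ⌊ κ₁ γ ≟ r ⌋ (G r)) ⟨
    ∑[ r < m ] (if ⌊ κ₁ γ ≟ r ⌋ then ∑[ s < m ] G r s else 0)
      ≡⟨ ∑-δ (κ₁ γ) (λ r → ∑[ s < m ] G r s) ⟩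
    ∑[ s < m ] G (κ₁ γ) s
      ≡⟨ ∑-δ (κ₂ γ) (λ s → 𝟙 (h (κ₁ γ) s)) ⟩
    𝟙 (h (κ₁ γ) (κ₂ γ)) ∎
    where
    G : Fin m → Fin m → ℕ
    G r s = if ⌊ κ₂ γ ≟ s ⌋ then 𝟙 (h r s) else 0

∑-mono-≤ : ∀ {n} {f g : Fin n → ℕ} → (∀ i → f i ≤ g i) → ∑[ i < n ] f i ≤ ∑[ i < n ] g i
∑-mono-≤ {zero}  f≤g = z≤n
∑-mono-≤ {suc n} f≤g = +-mono-≤ (f≤g zero) (∑-mono-≤ (f≤g ∘ suc))

∑-≡∧≤⇒≗ : ∀ {n} {f g : Fin n → ℕ} → (∀ i → f i ≤ g i) →
          ∑[ i < n ] f i ≡ ∑[ i < n ] g i → ∀ i → f i ≡ g i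
∑-≡∧≤⇒≗ {suc n} {f} {g} f≤g eq = λ { zero → f₀≡g₀ ; (suc i) → ∑-≡∧≤⇒≗ (f≤g ∘ suc) rest i }
  where
  F G : ℕ
  F = ∑[ i < n ] f (suc i)
  G = ∑[ i < n ] g (suc i)
  F≤G : F ≤ G
  F≤G = ∑-mono-≤ (f≤g ∘ suc)
  f₀≡g₀ : f zero ≡ g zero
  f₀≡g₀ = ≤-antisym (f≤g zero)
    (+-cancelʳ-≤ F (g zero) (f zero) (subst (g zero + F ≤_) (sym eq) (+-monoʳ-≤ (g zero) F≤G)))
  rest : F ≡ G
  rest = +-cancelˡ-≡ (f zero) F G (subst (λ x → f zero + F ≡ x + G) (sym f₀≡g₀) eq)

-- Finite quotients

record FiniteQuotient {A : Set} (_≈_ : A → A → Set) : Set where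
  field
    classes      : ℕ
    classOf      : A → Fin classes
    classOf-surj : ∀ i → ∃ λ x → classOf x ≡ i
    classOf-≡⇔   : ∀ x y → classOf x ≡ classOf y ⇔ x ≈ y

finQuotient : ∀ {N} {_≈_ : Fin N → Fin N → Set} → IsDecEquivalence _≈_ → FiniteQuotient _≈_
finQuotient {zero} _ = record
  { classes = 0 ; classOf = λ () ; classOf-surj = λ () ; classOf-≡⇔ = λ () }
finQuotient {suc N} {_≈_} isDecEq = extend (any? (λ j → zero ≈? suc j))
  where
  open IsDecEquivalence isDecEq renaming (_≟_ to _≈?_; refl to ≈-refl; sym to ≈-sym; trans to ≈-trans)
  open FiniteQuotient (finQuotient (On.isDecEquivalence suc isDecEq))

  extend : Dec (∃ λ j → zero ≈ suc j) → FiniteQuotient _≈_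
  extend (yes (j , 0≈j)) = record
    { classes      = classes
    ; classOf      = classOf ∘ rep
    ; classOf-surj = λ i → let (x , eq) = classOf-surj i in suc x , eq
    ; classOf-≡⇔   = λ x y → mk⇔
        (λ eq → ≈-trans (≈-sym (rep-≈ x)) (≈-trans (Equivalence.to (classOf-≡⇔ (rep x) (rep y)) eq) (rep-≈ y)))
        (λ x≈y → Equivalence.from (classOf-≡⇔ (rep x) (rep y)) (≈-trans (rep-≈ x) (≈-trans x≈y (≈-sym (rep-≈ y)))))
    }
    where
    rep : Fin (suc N) → Fin N
    rep zero    = j
    rep (suc i) = i
    rep-≈ : ∀ x → suc (rep x) ≈ x
    rep-≈ zero    = ≈-sym 0≈j
    rep-≈ (suc i) = ≈-refl
  extend (no none) = record
    { classes      = suc classes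
    ; classOf      = classOf′
    ; classOf-surj = λ { zero → zero , refl ; (suc i) → let (x , eq) = classOf-surj i in suc x , cong suc eq }
    ; classOf-≡⇔   = ≡⇔
    }
    where
    classOf′ : Fin (suc N) → Fin (suc classes)
    classOf′ zero    = zero
    classOf′ (suc i) = suc (classOf i)
    ≡⇔ : ∀ x y → classOf′ x ≡ classOf′ y ⇔ x ≈ y
    ≡⇔ zero    zero    = mk⇔ (λ _ → ≈-refl) (λ _ → refl)
    ≡⇔ zero    (suc y) = mk⇔ (λ ()) (λ 0≈y → ⊥-elim (none (y , 0≈y)))
    ≡⇔ (suc x) zero    = mk⇔ (λ ()) (λ x≈0 → ⊥-elim (none (x , ≈-sym x≈0)))
    ≡⇔ (suc x) (suc y) = mk⇔ (Equivalence.to (classOf-≡⇔ x y) ∘ suc-injective)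
                             (cong suc ∘ Equivalence.from (classOf-≡⇔ x y))

quotientVia : ∀ {N} {A : Set} {_≈_ : A → A → Set} → Fin N ↔ A → IsDecEquivalence _≈_ → FiniteQuotient _≈_
quotientVia {_≈_ = _≈_} e isDecEq = record
  { classes      = classes
  ; classOf      = classOf ∘ from
  ; classOf-surj = λ i → let (x , eq) = classOf-surj i in to x , trans (cong classOf (strictlyInverseʳ x)) eq
  ; classOf-≡⇔   = λ x y → subst₂ (λ u v → (classOf (from x) ≡ classOf (from y)) ⇔ (u ≈ v))
                             (strictlyInverseˡ x) (strictlyInverseˡ y) (classOf-≡⇔ (from x) (from y))
  }
  where
  open Inverse e
  open FiniteQuotient (finQuotient (On.isDecEquivalence to isDecEq))

-- Coherent configurations and algebraic isomorphisms

module _ {n} (Z : CC n) where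

  coherent-path-count : ∀ (h : Fin (m Z) → Fin (m Z) → Bool) {a b c d} → col Z a b ≡ col Z c d →
    count (λ γ → h (col Z a γ) (col Z γ b)) ≡ count (λ γ → h (col Z c γ) (col Z γ d))
  coherent-path-count h {a} {b} {c} {d} eq = begin
    count (λ γ → h (col Z a γ) (col Z γ b))
      ≡⟨ count-by-fibres (col Z a) (λ γ → col Z γ b) h ⟩
    ∑[ r < m Z ] ∑[ s < m Z ] (if h r s then inter Z r s a b else 0)
      ≡⟨ sum-cong-≗ (λ r → sum-cong-≗ (λ s → cong (λ k → if h r s then k else 0) (coh Z r s a b c d eq))) ⟩
    ∑[ r < m Z ] ∑[ s < m Z ] (if h r s then inter Z r s c d else 0)
      ≡⟨ count-by-fibres (col Z c) (λ γ → col Z γ d) h ⟨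
    count (λ γ → h (col Z c γ) (col Z γ d)) ∎
    where open ≡-Reasoning

module _ {n n'} {Y : CC n} {Y' : CC n'} (ψ : AlgIso Y Y') where

  f-injective : ∀ {r s} → f ψ r ≡ f ψ s → r ≡ s
  f-injective {r} {s} eq = trans (sym (gf ψ r)) (trans (cong (g ψ) eq) (gf ψ s))

  path-transfer : ∀ {a b a' b'} → f ψ (col Y a b) ≡ col Y' a' b' → ∀ γ →
    ∃ λ γ' → col Y' a' γ' ≡ f ψ (col Y a γ) × col Y' γ' b' ≡ f ψ (col Y γ b)
  path-transfer {a} {b} {a'} {b'} eq γ =
    let (γ' , onPath') = Equivalence.from (∃⇔0<count _) (subst (0 <_) (pres ψ r s a b a' b' eq) positive)
    in γ' , Equivalence.to (T-≟∧≟ {x = col Y' a' γ'} {f ψ r} {col Y' γ' b'} {f ψ s}) onPath'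
    where
    r s : Fin (m Y)
    r = col Y a γ
    s = col Y γ b
    positive : 0 < inter Y r s a b
    positive = Equivalence.to (∃⇔0<count _) (γ , Equivalence.from (T-≟∧≟ {x = r} {r} {s} {s}) (refl , refl))

  reflexive-reflected : ∀ {a b a'} → f ψ (col Y a b) ≡ col Y' a' a' → a ≡ b
  reflexive-reflected {a} {b} {a'} eq =
    let (γ' , a'γ' , γ'a') = path-transfer eq b
        a'≡γ' = diag Y' a' γ' a' (trans a'γ' eq)
    in diag Y a b b (f-injective (trans eq (trans (cong (λ z → col Y' z a') a'≡γ') γ'a')))

  inverse : AlgIso Y' Y
  inverse = record
    { f = g ψ ; g = f ψ ; gf = fg ψ ; fg = gf ψ
    ; pres = λ r s a b a' b' eq → sym (subst₂ (λ u v → inter Y (g ψ r) (g ψ s) a' b' ≡ inter Y' u v a b)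
               (fg ψ r) (fg ψ s) (pres ψ (g ψ r) (g ψ s) a' b' a b (trans (sym (cong (f ψ) eq)) (fg ψ _))))
    }

module _ {n n'} {Y : CC n} {Y' : CC n'} (ψ : AlgIso Y Y') where

  reflexive-preserved : ∀ {a a' b'} → f ψ (col Y a a) ≡ col Y' a' b' → a' ≡ b'
  reflexive-preserved eq = reflexive-reflected (inverse ψ) (trans (sym (cong (g ψ) eq)) (gf ψ _))

  source-preserved : ∀ {a b a' b'} → f ψ (col Y a b) ≡ col Y' a' b' → f ψ (col Y a a) ≡ col Y' a' a'
  source-preserved {a} {b} {a'} eq =
    let (γ' , a'γ' , _) = path-transfer ψ eq a
    in trans (sym a'γ') (cong (col Y' a') (sym (reflexive-preserved (sym a'γ'))))

  target-preserved : ∀ {a b a' b'} → f ψ (col Y a b) ≡ col Y' a' b' → f ψ (col Y b b) ≡ col Y' b' b'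
  target-preserved {a} {b} {a'} {b'} eq =
    let (γ' , _ , γ'b') = path-transfer ψ eq b
    in trans (sym γ'b') (cong (λ z → col Y' z b') (reflexive-preserved (sym γ'b')))

  fibre-colour-preserved : ∀ {u} → IsFiberColour Y u → IsFiberColour Y' (f ψ u)
  fibre-colour-preserved {u} fibre a' b' eq =
    let (a , b , ab∈u) = surj Y u
    in reflexive-preserved (trans (cong (f ψ) (trans (cong (col Y a) (fibre a b ab∈u)) ab∈u)) (sym eq))

_∘ᵃ_ : ∀ {n n' n''} {Y : CC n} {Y' : CC n'} {Y'' : CC n''} → AlgIso Y' Y'' → AlgIso Y Y' → AlgIso Y Y''
_∘ᵃ_ {Y = Y} {Y'} θ ψ = record
  { f = f θ ∘ f ψ ; g = g ψ ∘ g θ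
  ; gf = λ r → trans (cong (g ψ) (gf θ (f ψ r))) (gf ψ r)
  ; fg = λ r → trans (cong (f θ) (fg ψ (g θ r))) (fg θ r)
  ; pres = λ r s a b a'' b'' eq →
      let (a' , b' , ab') = surj Y' (f ψ (col Y a b))
      in trans (pres ψ r s a b a' b' (sym ab')) (pres θ (f ψ r) (f ψ s) a' b' a'' b'' (trans (cong (f θ) ab') eq))
  }

fibre-preimage : ∀ {n n'} {X : CC n} {X' : CC n'} (φ : AlgIso X X') α' →
                 ∃ λ α → f φ (col X α α) ≡ col X' α' α'
fibre-preimage {X = X} {X'} φ α' =
  let (a , b , ab) = surj X (g φ (col X' α' α'))
      φab = trans (cong (f φ) ab) (fg φ _)
  in a , trans (cong (f φ ∘ col X a) (reflexive-reflected φ φab)) φab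

-- X_α is computed by Weisfeiler–Leman refinement of the partition E₀ of Ω² by X-colour and
-- by membership in {(α, α)}: a step keeps two pairs related iff they have equally many
-- paths of every pair of classes.  Every coherent Z refining X with {(α, α)} basic stays
-- finer than each iterate, since by coherence of Z these path counts only depend on
-- Z-colours.  A step that changes anything relates strictly fewer pairs, so after
-- size E₀ + 1 steps the relation is stable, i.e. coherent.
module OnePointExtension {n} (X : CC n) (α : Fin n) where

  Pair : Set
  Pair = Fin n × Fin n

  BRel : Set
  BRel = Pair → Pair → Bool

  colˣ : Pair → Fin (m X)
  colˣ (a , b) = col X a b

  isPoint : Pair → Bool
  isPoint p = does (≡-dec _≟_ _≟_ p (α , α))

  SameKind : Pair → Pair → Set
  SameKind p q = colˣ p ≡ colˣ q × isPoint p ≡ isPoint q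

  E₀ : BRel
  E₀ p q = ⌊ (colˣ p ≟ colˣ q) ×-dec (isPoint p ≟ᵇ isPoint q) ⌋

  Σᴾ : (Pair → ℕ) → ℕ
  Σᴾ h = ∑[ a < n ] ∑[ b < n ] h (a , b)

  ∀ᴾ? : {P : Pair → Set} → (∀ p → Dec (P p)) → Dec (∀ p → P p)
  ∀ᴾ? P? = map′ (λ all (a , b) → all a b) (λ all a b → all (a , b)) (all? λ a → all? λ b → P? (a , b))

  paths : BRel → Pair → Pair → Pair → ℕ
  paths E (a , b) x y = count (λ γ → E (a , γ) x ∧ E (γ , b) y)

  SameCounts : BRel → Pair → Pair → Set
  SameCounts E p q = ∀ x y → paths E p x y ≡ paths E q x y

  step : BRel → BRel
  step E p q = E p q ∧ ⌊ ∀ᴾ? (λ x → ∀ᴾ? (λ y → paths E p x y ℕ.≟ paths E q x y)) ⌋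

  T-step : ∀ E p q → T (step E p q) ⇔ (T (E p q) × SameCounts E p q)
  T-step E p q = mk⇔
    (λ t → let (e , c) = Equivalence.to (T-∧ {E p q}) t in e , toWitness c)
    (λ (e , c) → Equivalence.from (T-∧ {E p q}) (e , fromWitness c))

  record Invariant (E : BRel) : Set where
    field
      isEquivalence : IsEquivalence (λ p q → T (E p q))
      transpose     : ∀ {a b c d} → T (E (a , b) (c , d)) → T (E (b , a) (d , c))
      sameKind      : ∀ {p q} → T (E p q) → SameKind p q
      coarsest      : ∀ (Z : CC n) → Refines Z X → PointBasic Z α →
                      ∀ {a b c d} → col Z a b ≡ col Z c d → T (E (a , b) (c , d))

    module ∼ = IsEquivalence isEquivalence

    resp : ∀ {p q} x → T (E p q) → E p x ≡ E q x
    resp x pq = T-⇔⇒≡ (mk⇔ (∼.trans (∼.sym pq)) (∼.trans pq))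

    transpose-≡ : ∀ a b c d → E (a , b) (c , d) ≡ E (b , a) (d , c)
    transpose-≡ a b c d = T-⇔⇒≡ (mk⇔ transpose transpose)

  open Invariant

  isPoint-swap : ∀ a b → isPoint (a , b) ≡ isPoint (b , a)
  isPoint-swap a b = does-⇔ (mk⇔ swap swap) (≡-dec _≟_ _≟_ (a , b) (α , α)) (≡-dec _≟_ _≟_ (b , a) (α , α))
    where
    swap : ∀ {a b} → (a , b) ≡ (α , α) → (b , a) ≡ (α , α)
    swap refl = refl

  isPoint-basic : ∀ (Z : CC n) → PointBasic Z α → ∀ {a b c d} → col Z a b ≡ col Z c d →
                  isPoint (a , b) ≡ isPoint (c , d)
  isPoint-basic Z basic {a} {b} {c} {d} eq =
    does-⇔ (mk⇔ (λ { refl → pointOf (sym eq) }) (λ { refl → pointOf eq }))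
           (≡-dec _≟_ _≟_ (a , b) (α , α)) (≡-dec _≟_ _≟_ (c , d) (α , α))
    where
    pointOf : ∀ {x y} → col Z x y ≡ col Z α α → (x , y) ≡ (α , α)
    pointOf e = let (x≡α , y≡α) = basic _ _ e in cong₂ _,_ x≡α y≡α

  invariant₀ : Invariant E₀
  invariant₀ = record
    { isEquivalence = record
      { refl  = fromWitness (refl , refl)
      ; sym   = λ t → let (c , i) = toWitness t in fromWitness (sym c , sym i)
      ; trans = λ t u → let (c , i) = toWitness t ; (c' , i') = toWitness u in fromWitness (trans c c' , trans i i')
      }
    ; transpose = λ {a} {b} {c} {d} t → let (col≡ , pt≡) = toWitness t in
        fromWitness (trans* X a b c d col≡ , trans (sym (isPoint-swap a b)) (trans pt≡ (isPoint-swap c d)))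
    ; sameKind = toWitness
    ; coarsest = λ Z refines basic {a} {b} {c} {d} eq →
        fromWitness (refines a b c d eq , isPoint-basic Z basic eq)
    }

  paths-transpose : ∀ {E} → Invariant E → ∀ a b x₁ x₂ y₁ y₂ →
    paths E (b , a) (x₁ , x₂) (y₁ , y₂) ≡ paths E (a , b) (y₂ , y₁) (x₂ , x₁)
  paths-transpose {E} I a b x₁ x₂ y₁ y₂ = count-cong λ γ →
    trans (cong₂ _∧_ (transpose-≡ I b γ x₁ x₂) (transpose-≡ I γ a y₁ y₂))
          (∧-comm (E (γ , b) (x₂ , x₁)) (E (a , γ) (y₂ , y₁)))

  sameCounts-coarsest : ∀ {E} → Invariant E → ∀ (Z : CC n) → Refines Z X → PointBasic Z α →
    ∀ {a b c d} → col Z a b ≡ col Z c d → SameCounts E (a , b) (c , d)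
  sameCounts-coarsest {E} I Z refines basic {a} {b} {c} {d} eq x y = begin
    paths E (a , b) x y                       ≡⟨ count-cong (viaColours a b) ⟩
    count (λ γ → h (col Z a γ) (col Z γ b))  ≡⟨ coherent-path-count Z h eq ⟩
    count (λ γ → h (col Z c γ) (col Z γ d))  ≡⟨ count-cong (viaColours c d) ⟨
    paths E (c , d) x y                       ∎
    where
    open ≡-Reasoning
    rep : Fin (m Z) → Pair
    rep r = let (u , v , _) = surj Z r in u , v
    byColour : ∀ u v z → E (u , v) z ≡ E (rep (col Z u v)) z
    byColour u v z = resp I z (coarsest I Z refines basic (sym (proj₂ (proj₂ (surj Z (col Z u v))))))
    h : Fin (m Z) → Fin (m Z) → Bool
    h r s = E (rep r) x ∧ E (rep s) y
    viaColours : ∀ u v γ → (E (u , γ) x ∧ E (γ , v) y) ≡ h (col Z u γ) (col Z γ v)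
    viaColours u v γ = cong₂ _∧_ (byColour u γ x) (byColour γ v y)

  invariant-step : ∀ {E} → Invariant E → Invariant (step E)
  invariant-step {E} I = record
    { isEquivalence = record
      { refl  = λ {p} → Equivalence.from (T-step E p p) (∼.refl I , λ _ _ → refl)
      ; sym   = λ {p} {q} t → let (e , c) = Equivalence.to (T-step E p q) t in
                  Equivalence.from (T-step E q p) (∼.sym I e , λ x y → sym (c x y))
      ; trans = λ {p} {q} {r} t u →
                  let (e , c) = Equivalence.to (T-step E p q) t ; (e' , c') = Equivalence.to (T-step E q r) u in
                  Equivalence.from (T-step E p r) (∼.trans I e e' , λ x y → trans (c x y) (c' x y))
      }
    ; transpose = λ {a} {b} {c} {d} t → let (e , cnt) = Equivalence.to (T-step E (a , b) (c , d)) t in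
        Equivalence.from (T-step E (b , a) (d , c)) (transpose I e , λ { (x₁ , x₂) (y₁ , y₂) →
          trans (paths-transpose I a b x₁ x₂ y₁ y₂)
                (trans (cnt (y₂ , y₁) (x₂ , x₁)) (sym (paths-transpose I c d x₁ x₂ y₁ y₂))) })
    ; sameKind = λ {p} {q} t → sameKind I (proj₁ (Equivalence.to (T-step E p q) t))
    ; coarsest = λ Z refines basic {a} {b} {c} {d} eq →
        Equivalence.from (T-step E (a , b) (c , d))
          (coarsest I Z refines basic eq , sameCounts-coarsest I Z refines basic eq)
    }

  Stable : BRel → Set
  Stable E = ∀ {p q} → T (E p q) → SameCounts E p q

  Σᴾ-mono-≤ : ∀ {h k : Pair → ℕ} → (∀ p → h p ≤ k p) → Σᴾ h ≤ Σᴾ k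
  Σᴾ-mono-≤ h≤k = ∑-mono-≤ (λ a → ∑-mono-≤ (λ b → h≤k (a , b)))

  Σᴾ-≡∧≤⇒≗ : ∀ {h k : Pair → ℕ} → (∀ p → h p ≤ k p) → Σᴾ h ≡ Σᴾ k → ∀ p → h p ≡ k p
  Σᴾ-≡∧≤⇒≗ h≤k eq (a , b) =
    ∑-≡∧≤⇒≗ (λ b → h≤k (a , b)) (∑-≡∧≤⇒≗ (λ a → ∑-mono-≤ (λ b → h≤k (a , b))) eq a) b

  size : BRel → ℕ
  size E = Σᴾ λ p → Σᴾ λ q → 𝟙 (E p q)

  step-shrinks : ∀ E p q → 𝟙 (step E p q) ≤ 𝟙 (E p q)
  step-shrinks E p q = 𝟙-mono (proj₁ ∘ Equivalence.to (T-step E p q))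

  size-step-≤ : ∀ E → size (step E) ≤ size E
  size-step-≤ E = Σᴾ-mono-≤ (λ p → Σᴾ-mono-≤ (step-shrinks E p))

  size-step-≡⇒stable : ∀ E → size (step E) ≡ size E → Stable E
  size-step-≡⇒stable E eq {p} {q} e = proj₂ (Equivalence.to (T-step E p q) (subst T (sym stepE≡E) e))
    where
    rowsEqual : Σᴾ (λ q → 𝟙 (step E p q)) ≡ Σᴾ (λ q → 𝟙 (E p q))
    rowsEqual = Σᴾ-≡∧≤⇒≗ (λ p → Σᴾ-mono-≤ (step-shrinks E p)) eq p
    stepE≡E : step E p q ≡ E p q
    stepE≡E = 𝟙-injective (Σᴾ-≡∧≤⇒≗ (step-shrinks E p) rowsEqual q)

  refine : ℕ → BRel → BRel
  refine zero    E = E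
  refine (suc k) E with size (step E) ℕ.≟ size E
  ... | yes _ = E
  ... | no  _ = refine k (step E)

  refine-invariant : ∀ k {E} → Invariant E → Invariant (refine k E)
  refine-invariant zero    I = I
  refine-invariant (suc k) {E} I with size (step E) ℕ.≟ size E
  ... | yes _ = I
  ... | no  _ = refine-invariant k (invariant-step I)

  refine-stable : ∀ k E → size E < k → Stable (refine k E)
  refine-stable (suc k) E (s≤s sizeE≤k) with size (step E) ℕ.≟ size E
  ... | yes eq = size-step-≡⇒stable E eq
  ... | no  ne = refine-stable k (step E) (<-≤-trans (≤∧≢⇒< (size-step-≤ E) ne) sizeE≤k)

  E∞ : BRel
  E∞ = refine (suc (size E₀)) E₀

  invariant∞ : Invariant E∞
  invariant∞ = refine-invariant (suc (size E₀)) invariant₀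

  stable∞ : Stable E∞
  stable∞ = refine-stable (suc (size E₀)) E₀ ≤-refl

  isDecEquivalence∞ : IsDecEquivalence (λ p q → T (E∞ p q))
  isDecEquivalence∞ = record { isEquivalence = isEquivalence invariant∞ ; _≟_ = λ p q → T? (E∞ p q) }

  open FiniteQuotient (quotientVia (*↔× {n} {n}) isDecEquivalence∞)

  rep : Fin classes → Pair
  rep r = proj₁ (classOf-surj r)

  matches-class : ∀ p r → ⌊ classOf p ≟ r ⌋ ≡ E∞ p (rep r)
  matches-class p r = subst (λ r' → ⌊ classOf p ≟ r' ⌋ ≡ E∞ p (rep r)) (proj₂ (classOf-surj r))
    (trans (isYes≗does (classOf p ≟ classOf (rep r)))
           (does-⇔ (classOf-≡⇔ p (rep r)) (classOf p ≟ classOf (rep r)) (T? (E∞ p (rep r)))))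

  E∞-related : ∀ {a b c d} → classOf (a , b) ≡ classOf (c , d) → T (E∞ (a , b) (c , d))
  E∞-related = Equivalence.to (classOf-≡⇔ _ _)

  classes-as-paths : ∀ r s a b →
    count (λ γ → ⌊ classOf (a , γ) ≟ r ⌋ ∧ ⌊ classOf (γ , b) ≟ s ⌋) ≡ paths E∞ (a , b) (rep r) (rep s)
  classes-as-paths r s a b = count-cong (λ γ → cong₂ _∧_ (matches-class (a , γ) r) (matches-class (γ , b) s))

  point-class : ∀ {p} → isPoint p ≡ isPoint (α , α) → p ≡ (α , α)
  point-class {p} eq with ≡-dec _≟_ _≟_ p (α , α)
  ... | yes p≡αα = p≡αα
  ... | no  _    = ⊥-elim (false≢true (trans eq (dec-true (≡-dec _≟_ _≟_ (α , α) (α , α)) refl)))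
    where
    false≢true : false ≡ true → ⊥
    false≢true ()

  Y : CC n
  Y = record
    { m      = classes
    ; col    = λ a b → classOf (a , b)
    ; surj   = λ r → let ((a , b) , eq) = classOf-surj r in a , b , eq
    ; diag   = λ a b c eq → diag X a b c (proj₁ (sameKind invariant∞ (E∞-related eq)))
    ; trans* = λ a b c d eq → Equivalence.from (classOf-≡⇔ _ _) (transpose invariant∞ (E∞-related eq))
    ; coh    = λ r s a b c d eq →
        trans (classes-as-paths r s a b)
              (trans (stable∞ (E∞-related eq) (rep r) (rep s)) (sym (classes-as-paths r s c d)))
    }

  isOnePointExt : IsOnePointExt X α Y
  isOnePointExt =
      (λ a b c d eq → proj₁ (sameKind invariant∞ (E∞-related eq)))
    , (λ a b eq → let ab≡αα = point-class (proj₂ (sameKind invariant∞ (E∞-related eq)))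
                  in cong proj₁ ab≡αα , cong proj₂ ab≡αα)
    , (λ Z refines basic a b c d eq → Equivalence.from (classOf-≡⇔ _ _) (coarsest invariant∞ Z refines basic eq))

onePointExtension : ∀ {n} (X : CC n) (α : Fin n) → Σ (CC n) (IsOnePointExt X α)
onePointExtension X α = OnePointExtension.Y X α , OnePointExtension.isOnePointExt X α

-- Extensions of algebraic isomorphisms

FibreIsRow : ∀ {n} (X : CC n) (α : Fin n) (Y : CC n) → Fin (m Y) → Fin (m X) → Set
FibreIsRow X α Y u s = ∀ b → (col Y b b ≡ u) ⇔ (col X α b ≡ s)

module Extension {n n'} {X : CC n} {X' : CC n'} (φ : AlgIso X X') {α α'} {Y : CC n} {Y' : CC n'}
                 (Y-refines : Refines Y X) (ψ : AlgIso Y Y') (ext : IsExtension φ α α' Y Y' ψ) where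

  _⊆_ : Fin (m Y) → Fin (m X) → Set
  u ⊆ s = _⊆ᵇ_ {Y = Y} {X = X} u s

  _⊆′_ : Fin (m Y') → Fin (m X') → Set
  u' ⊆′ s' = _⊆ᵇ_ {Y = Y'} {X = X'} u' s'

  ⊆-preserved : ∀ {u s} → u ⊆ s → f ψ u ⊆′ f φ s
  ⊆-preserved {u} {s} u⊆s a' b' eq = Equivalence.to (proj₁ ext s a' b') (u , u⊆s , sym eq)

  ⊆-lifted : ∀ {a' b' s} → col X' a' b' ≡ f φ s → ∃ λ u → u ⊆ s × f ψ u ≡ col Y' a' b'
  ⊆-lifted {a'} {b'} {s} = Equivalence.from (proj₁ ext s a' b')

  colour-agrees : ∀ {a b a' b'} → f ψ (col Y a b) ≡ col Y' a' b' → col X' a' b' ≡ f φ (col X a b)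
  colour-agrees {a} {b} eq = ⊆-preserved (λ c d cd → Y-refines c d a b cd) _ _ (sym eq)

  ⊆-reflected : ∀ {u s} → f ψ u ⊆′ f φ s → u ⊆ s
  ⊆-reflected {u} h a b ab =
    let (a' , b' , ab') = surj Y' (f ψ u)
    in f-injective φ (trans (sym (colour-agrees (trans (cong (f ψ) ab) (sym ab')))) (h a' b' ab'))

module _ {n n'} {X : CC n} {X' : CC n'} (φ : AlgIso X X') {α α'} {Y : CC n} {Y' : CC n'}
         (Y-ext : IsOnePointExt X α Y) (Y'-ext : IsOnePointExt X' α' Y')
         (ψ : AlgIso Y Y') (ext : IsExtension φ α α' Y Y' ψ) where

  open Extension φ (proj₁ Y-ext) ψ ext

  starts-at-α : ∀ {a b b'} → f ψ (col Y a b) ≡ col Y' α' b' → a ≡ α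
  starts-at-α {a} eq = proj₁ (proj₁ (proj₂ Y-ext) a a (f-injective ψ (trans (source-preserved ψ eq) (sym (proj₂ ext)))))

  row-match : ∀ b' → ∃ λ b → f ψ (col Y α b) ≡ col Y' α' b'
  row-match b' =
    let (a , b , ab) = surj Y (g ψ (col Y' α' b'))
        ψab = trans (cong (f ψ) ab) (fg ψ _)
    in b , subst (λ z → f ψ (col Y z b) ≡ col Y' α' b') (starts-at-α ψab) ψab

  row-match⁻ : ∀ b → ∃ λ b' → f ψ (col Y α b) ≡ col Y' α' b'
  row-match⁻ b =
    let (a' , b' , ab') = surj Y' (f ψ (col Y α b))
        a'a'≡α'α' = trans (sym (source-preserved ψ (sym ab'))) (proj₂ ext)
    in b' , trans (sym ab') (cong (λ z → col Y' z b') (proj₁ (proj₁ (proj₂ Y'-ext) a' a' a'a'≡α'α')))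

  fibre-match : ∀ {u s u' s'} → f ψ u ≡ u' → f φ s ≡ s' → FibreIsRow X α Y u s → FibreIsRow X' α' Y' u' s'
  fibre-match {u} {s} refl refl fibre≡row b' = mk⇔
    (λ e → trans row (cong (f φ) (Equivalence.to (fibre≡row b) (f-injective ψ (trans diagonal e)))))
    (λ e → trans (sym diagonal) (cong (f ψ) (Equivalence.from (fibre≡row b) (f-injective φ (trans (sym row) e)))))
    where
    b = proj₁ (row-match b')
    diagonal : f ψ (col Y b b) ≡ col Y' b' b'
    diagonal = target-preserved ψ (proj₂ (row-match b'))
    row : col X' α' b' ≡ f φ (col X α b)
    row = colour-agrees (proj₂ (row-match b'))

  S1-transfer : S1 X α Y → S1 X' α' Y'
  S1-transfer (fibres⇒rows , rows⇒fibres) = fibres⇒rows′ , rows⇒fibres′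
    where
    fibres⇒rows′ : ∀ u' → IsFiberColour Y' u' →
                   ∃ λ s' → (∃ λ b' → col X' α' b' ≡ s') × FibreIsRow X' α' Y' u' s'
    fibres⇒rows′ u' fibre' =
      let (s , (b , αb) , fibre≡row) = fibres⇒rows (g ψ u') (fibre-colour-preserved (inverse ψ) fibre')
          (b' , ψαb) = row-match⁻ b
      in f φ s , (b' , trans (colour-agrees ψαb) (cong (f φ) αb)) , fibre-match (fg ψ u') refl fibre≡row
    rows⇒fibres′ : ∀ s' → (∃ λ b' → col X' α' b' ≡ s') →
                   ∃ λ u' → IsFiberColour Y' u' × FibreIsRow X' α' Y' u' s'
    rows⇒fibres′ s' (b' , α'b') =
      let (b , ψαb) = row-match b'
          αb = f-injective φ (trans (sym (colour-agrees ψαb)) (trans α'b' (sym (fg φ s'))))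
          (u , fibre , fibre≡row) = rows⇒fibres (g φ s') (b , αb)
      in f ψ u , fibre-colour-preserved ψ fibre , fibre-match refl (fg φ s') fibre≡row

extension-compose : ∀ {n n'} {X : CC n} {X' : CC n'} (φ : AlgIso X X') {α α' β'}
  {Y : CC n} {Y' Z' : CC n'} {ψ₁ : AlgIso Y Y'} {ψ₂ : AlgIso Y Z'} → Refines Y X →
  IsExtension φ α α' Y Y' ψ₁ → IsExtension φ α β' Y Z' ψ₂ →
  IsExtension (idIso X') α' β' Y' Z' (ψ₂ ∘ᵃ inverse ψ₁)
extension-compose {X' = X'} φ {α} {α'} {β'} {Y} {Y'} {Z'} {ψ₁} {ψ₂} Y-refines ext₁ ext₂ =
  (λ s' a'' b'' → mk⇔ (to s') (from s')) , point
  where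
  module E₁ = Extension φ Y-refines ψ₁ ext₁
  module E₂ = Extension φ Y-refines ψ₂ ext₂
  to : ∀ s' {a'' b''} → (∃ λ u' → u' E₁.⊆′ s' × f ψ₂ (g ψ₁ u') ≡ col Z' a'' b'') → col X' a'' b'' ≡ s'
  to s' {a''} {b''} (u' , u'⊆s' , eq) =
    let u⊆s = E₁.⊆-reflected {g ψ₁ u'} {g φ s'} (λ a' b' e → trans (u'⊆s' a' b' (trans e (fg ψ₁ u'))) (sym (fg φ s')))
    in trans (E₂.⊆-preserved u⊆s a'' b'' (sym eq)) (fg φ s')
  from : ∀ s' {a'' b''} → col X' a'' b'' ≡ s' → ∃ λ u' → u' E₁.⊆′ s' × f ψ₂ (g ψ₁ u') ≡ col Z' a'' b''
  from s' e =
    let (v , v⊆s , ψ₂v) = E₂.⊆-lifted (trans e (sym (fg φ s')))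
    in f ψ₁ v , (λ a b ab → trans (E₁.⊆-preserved v⊆s a b ab) (fg φ s')) , trans (cong (f ψ₂) (gf ψ₁ v)) ψ₂v
  point : f ψ₂ (g ψ₁ (col Y' α' α')) ≡ col Z' β' β'
  point = trans (cong (f ψ₂) (trans (cong (g ψ₁) (sym (proj₂ ext₁))) (gf ψ₁ _))) (proj₂ ext₂)

lemma4p7 : ∀ {n n' : ℕ} (X : CC n) (X' : CC n') (φ : AlgIso X X') →
           SesquiclosedCC X → SesquiclosedIso φ → SesquiclosedCC X'
lemma4p7 X X' φ (S1-X , _) sesquiclosed-φ = S1-X' , S2-X'
  where
  S1-X' : ∀ α' Y' → IsOnePointExt X' α' Y' → S1 X' α' Y'
  S1-X' α' Y' Y'-ext =
    let (α , φαα) = fibre-preimage φ α'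
        (Y , Y-ext) = onePointExtension X α
        (ψ , ext) = sesquiclosed-φ α α' φαα Y Y' Y-ext Y'-ext
    in S1-transfer φ Y-ext Y'-ext ψ ext (S1-X α Y Y-ext)
  S2-X' : SesquiclosedIso (idIso X')
  S2-X' α' β' α'α'≡β'β' Y' Z' Y'-ext Z'-ext =
    let (α , φαα) = fibre-preimage φ α'
        (Y , Y-ext) = onePointExtension X α
        (ψ₁ , ext₁) = sesquiclosed-φ α α' φαα Y Y' Y-ext Y'-ext
        (ψ₂ , ext₂) = sesquiclosed-φ α β' (trans φαα α'α'≡β'β') Y Z' Y-ext Z'-ext
    in ψ₂ ∘ᵃ inverse ψ₁ , extension-compose φ {α} {ψ₁ = ψ₁} {ψ₂} (proj₁ Y-ext) ext₁ ext₂
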